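{- A sequence $(a_n(q))_{n\ge1}$ in $\mathbb{Z}[q]$ is a $q$-Gauss sequence if and only if $a_{p^rm}(q)\equiv a_{p^{r-1}m}(q^p)\pmod{[p^r]_{q^m}}$ for all primes $p$ and integers $m,r\ge1$ with $p\nmid m$.
   Context: $[n]_q=1+q+\cdots+q^{n-1}$ and $[n]_{q^m}$ is this polynomial evaluated at $q^m$; $\mu$ is the Möbius function; congruences are in $\mathbb{Z}[q]$. $(a_n(q))$ is a $q$-Gauss sequence if $\sum_{d\mid n}\mu(d)a_{n/d}(q^d)\equiv0\pmod{[n]_q}$ for all $n\ge1$. -}

module Defs where

open import Data.Nat as ℕ using (ℕ; zero; suc; _∸_; _^_; _/_)
open import Data.Nat.Divisibility using (_∣_; _∣?_)
open import Data.Nat.Primality using (Prime; prime?)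
open import Data.Integer as ℤ using (ℤ; +_; -_)
open import Data.List using (List; []; _∷_; map; foldr; filter; upTo; replicate; length; _++_)
open import Data.Product using (∃)
open import Relation.Nullary using (does)
open import Relation.Nullary.Decidable using (_×-dec_)
open import Relation.Binary.PropositionalEquality using (_≡_)
open import Data.Bool using (if_then_else_)

-- Polynomials in ℤ[q] as coefficient lists (constant term first);
-- equality is coefficientwise (so trailing zeros are irrelevant).
Poly : Set
Poly = List ℤ

coeff : Poly → ℕ → ℤ
coeff []       _       = + 0
coeff (c ∷ f)  zero    = c
coeff (c ∷ f)  (suc i) = coeff f i

_≈P_ : Poly → Poly → Set
f ≈P g = ∀ i → coeff f i ≡ coeff g i

infixl 6 _+P_ _-P_
infixl 7 _*P_

_+P_ : Poly → Poly → Poly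
[]      +P g       = g
(c ∷ f) +P []      = c ∷ f
(c ∷ f) +P (d ∷ g) = (c ℤ.+ d) ∷ (f +P g)

negP : Poly → Poly
negP = map -_

_-P_ : Poly → Poly → Poly
f -P g = f +P negP g

_*P_ : Poly → Poly → Poly
[]      *P g = []
(c ∷ f) *P g = map (c ℤ.*_) g +P (+ 0 ∷ (f *P g))

compose : Poly → Poly → Poly
compose f g = foldr (λ c acc → (c ∷ []) +P (g *P acc)) [] f

monomial : ℕ → Poly
monomial d = replicate d (+ 0) ++ (+ 1 ∷ [])

subst : ℕ → Poly → Poly
subst d f = compose f (monomial d)

qInt : ℕ → Poly
qInt n = replicate n (+ 1)

_≡_[modP_] : Poly → Poly → Poly → Set
f ≡ g [modP h ] = ∃ λ k → (f -P g) ≈P (h *P k)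

squareDivisors : ℕ → List ℕ
squareDivisors n = filter (λ k → (k ℕ.* k) ∣? n) (map (λ j → suc (suc j)) (upTo n))

primeDivisors : ℕ → List ℕ
primeDivisors n = filter (λ p → prime? p ×-dec (p ∣? n)) (upTo (suc n))

negOnePow : ℕ → ℤ
negOnePow zero    = + 1
negOnePow (suc k) = - negOnePow k

μ : ℕ → ℤ
μ n with squareDivisors n
... | []    = negOnePow (length (primeDivisors n))
... | _ ∷ _ = + 0

sumP : List Poly → Poly
sumP = foldr _+P_ []

-- Σ_{d ∣ n} μ(d) a_{n/d}(q^d), d ranging over positive divisors of n
mobiusSum : (ℕ → Poly) → ℕ → Poly
mobiusSum a n =
  sumP (map (λ k → map (μ (suc k) ℤ.*_) (subst (suc k) (a (n / suc k))))
            (filter (λ k → suc k ∣? n) (upTo n)))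

-- q-Gauss sequence (a_n)_{n ≥ 1}; the value a 0 is irrelevant
IsQGauss : (ℕ → Poly) → Set
IsQGauss a = ∀ n → 1 ℕ.≤ n → mobiusSum a n ≡ [] [modP qInt n ]

{-# OPTIONS --safe #-}

-- Fix a prime p and write n = p^(r+1) m with p ∤ m. The divisors of n on which μ does not
-- vanish are d and dp with d ∣ m, and μ(dp) = −μ(d); hence the Möbius sum of (a_k) at n
-- equals the Möbius sum at m of the defect c ↦ a_(p^(r+1) c)(q) − a_(p^r c)(q^p).
-- Since [n]_q = [m]_q [p^(r+1)]_(q^m), and substituting q ↦ q^d into [p^(r+1)]_(q^(m/d))
-- gives [p^(r+1)]_(q^m), strong induction on m turns the Gauss congruence at n into the
-- congruence for the defect at m. Conversely, the congruences for the defect give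
-- [n]_q ∣ [m]_q f for every prime p ∣ n, where f is the Möbius sum at n. The k with
-- [n]_q ∣ [k]_q f form a gcd-closed set, because [a + b]_q = [a]_q + q^a [b]_q, [j k]_q is a
-- multiple of [k]_q, and Bézout; it contains n and, for each prime p ∣ n, a number prime to p,
-- so it contains 1.

module Submission where

open import Defs
open import Algebra.Bundles using (AbelianGroup; CommutativeMonoid; CommutativeRing)
open import Algebra.Structures using (IsAbelianGroup)
open import Data.Integer as ℤ using (ℤ; +_; -_)
import Data.Integer.Properties as ℤ
open import Data.List using (List; []; _∷_; _++_; length; map; filter; foldr; upTo)
import Data.List.Properties as List
open import Data.List.Membership.Propositional using (_∈_)
open import Data.List.Membership.Propositional.Properties
  using (∉[]; ∈-filter⁺; ∈-filter⁻; ∈-map⁺; ∈-map⁻; ∈-upTo⁺)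
open import Data.List.Relation.Unary.All using (_∷_)
open import Data.List.Relation.Unary.Any using (here)
open import Data.Maybe using (Maybe; just; nothing)
open import Data.Nat as ℕ
  using (ℕ; zero; suc; _*_; _^_; _∸_; _/_; _≤_; _<_; _≤′_; ≤′-reflexive; ≤′-step; s≤s; z≤n; NonZero)
import Data.Nat.Properties as ℕ
open import Data.Nat.Coprimality using (Coprime; coprime-divisor)
open import Data.Nat.DivMod using (*-/-assoc; m*n/o*n≡m/o; n/1≡n; m*n/n≡m)
open import Data.Nat.Divisibility
  using (_∣_; _∣?_; divides; 0∣⇒≡0; 1∣_; ∣-refl; ∣-trans; ∣⇒≤; m∣m*n; n∣m*n; ∣m⇒∣m*n; ∣n⇒∣m*n;
         ∣m+n∣m⇒∣n; ∣m∣n⇒∣m+n; *-pres-∣; *-monoˡ-∣; *-cancelʳ-∣)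
open import Data.Nat.GCD using (gcd; gcd[m,n]∣m; gcd[m,n]∣n; gcd[m,n]≢0; gcd-GCD; module Bézout)
open import Data.Nat.Induction using (<-rec)
open import Data.Nat.ListAction using (product)
open import Data.Nat.Primality
  using (Prime; prime?; euclidsLemma; prime⇒irreducible; prime⇒nonTrivial; prime⇒nonZero)
open import Data.Nat.Primality.Factorisation using (factorise)
open import Data.Nat.Tactic.RingSolver using () renaming (solve-∀ to solve-ℕ)
open import Data.Product using (_×_; _,_; ∃; proj₂)
open import Data.Sum using (_⊎_; inj₁; inj₂)
open import Function using (_∘_; it)
open import Function.Bundles using (_⇔_; mk⇔)
open import Relation.Binary.Bundles using (Setoid)
open import Relation.Binary.PropositionalEquality as ≡ using (_≡_; _≢_; refl; cong; cong₂)
open import Relation.Binary.Structures using (IsEquivalence)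
open import Relation.Nullary using (¬_; Dec; yes; no; contradiction; ¬?)
open import Relation.Nullary.Decidable using (_×-dec_)
open import Relation.Unary using (Pred; Decidable)
open import Tactic.RingSolver using (solve-∀)
open import Tactic.RingSolver.Core.AlmostCommutativeRing using (AlmostCommutativeRing; fromCommutativeRing)

-- Elementary number theory

∤prime⇒coprime : ∀ {p d} → Prime p → ¬ p ∣ d → Coprime d p
∤prime⇒coprime p-prime p∤d (i∣d , i∣p) with prime⇒irreducible p-prime i∣p
... | inj₁ i≡1  = i≡1
... | inj₂ refl = contradiction i∣d p∤d

∣p^k*m⇒∣m : ∀ {p d} → Prime p → ¬ p ∣ d → ∀ k {m} → d ∣ p ^ k * m → d ∣ m
∣p^k*m⇒∣m {p} {d} p-prime p∤d zero    {m} d∣ = ≡.subst (d ∣_) (ℕ.+-identityʳ m) d∣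
∣p^k*m⇒∣m {p} {d} p-prime p∤d (suc k) {m} d∣ = ∣p^k*m⇒∣m p-prime p∤d k
  (coprime-divisor (∤prime⇒coprime p-prime p∤d) (≡.subst (d ∣_) (ℕ.*-assoc p (p ^ k) m) d∣))

prime-factor : ∀ {n} → 2 ≤ n → ∃ λ p → Prime p × p ∣ n
prime-factor {suc zero} (s≤s ())
prime-factor {n@(suc (suc _))} _ with factorise n
... | record { factors = [] ; isFactorisation = () }
... | record { factors = p ∷ ps ; isFactorisation = n≡p*ps ; factorsPrime = p-prime ∷ _ } =
  p , p-prime , divides (product ps) (≡.trans n≡p*ps (ℕ.*-comm p (product ps)))

∣prime⇒≡ : ∀ {ℓ p} → Prime ℓ → Prime p → ℓ ∣ p → ℓ ≡ p
∣prime⇒≡ ℓ-prime p-prime ℓ∣p with prime⇒irreducible p-prime ℓ∣p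
... | inj₂ ℓ≡p = ℓ≡p
... | inj₁ refl = contradiction (ℕ.nonTrivial⇒n>1 1 {{prime⇒nonTrivial ℓ-prime}}) (ℕ.<-irrefl refl)

∣⇒nonZero : ∀ {d n} → .{{_ : NonZero n}} → d ∣ n → NonZero d
∣⇒nonZero {zero}  {n} 0∣n = contradiction (0∣⇒≡0 0∣n) (ℕ.≢-nonZero⁻¹ n)
∣⇒nonZero {suc _}     _   = _

prime-power-split : ∀ {p n} → Prime p → .{{_ : NonZero n}} → p ∣ n →
                    ∃ λ r → ∃ λ m → n ≡ p ^ suc r * m × ¬ p ∣ m
prime-power-split {p} p-prime = <-rec Split split _
  where
  Split : ℕ → Set
  Split n = .{{NonZero n}} → p ∣ n → ∃ λ r → ∃ λ m → n ≡ p ^ suc r * m × ¬ p ∣ m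

  split : ∀ n → (∀ {c} → c < n → Split c) → Split n
  split n rec (divides c n≡cp) with p ∣? c
  ... | no  p∤c = 0 , c , ≡.trans n≡cp (reorder c p) , p∤c
    where
    reorder : ∀ x y → x * y ≡ y * 1 * x
    reorder = solve-ℕ
  ... | yes p∣c with rec c<n {{c≢0}} p∣c
    where
    c≢0 : NonZero c
    c≢0 = ℕ.m*n≢0⇒m≢0 c {{≡.subst NonZero n≡cp it}}
    c<n : c < n
    c<n = ≡.subst (c <_) (≡.sym n≡cp)
                  (ℕ.m<m*n c p {{c≢0}} (ℕ.nonTrivial⇒n>1 p {{prime⇒nonTrivial p-prime}}))
  ... | r , m , c≡p^[1+r]m , p∤m =
    suc r , m , ≡.trans n≡cp (≡.trans (cong (_* p) c≡p^[1+r]m) (reorder (p ^ suc r) p m)) , p∤m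
    where
    reorder : ∀ x y z → x * z * y ≡ y * x * z
    reorder = solve-ℕ

GcdClosed : Pred ℕ _ → Set
GcdClosed S = ∀ {a b} → S a → S b → S (gcd a b)

gcdClosed⇒1∈ : ∀ {S} → GcdClosed S → ∀ {n} → n ≢ 0 → S n →
               (∀ p → Prime p → p ∣ n → ∃ λ m → ¬ p ∣ m × S m) → S 1
gcdClosed⇒1∈ {S} closed {n} n≢0 n∈S avoid = <-rec Descends descend n n≢0 ∣-refl n∈S
  where
  Descends : Pred ℕ _
  Descends g = g ≢ 0 → g ∣ n → S g → S 1

  descend : ∀ g → (∀ {h} → h < g → Descends h) → Descends g
  descend zero                _   g≢0 = contradiction refl g≢0
  descend (suc zero)          _   _   _   1∈S = 1∈S
  descend g@(suc (suc _)) rec _ g∣n g∈S with prime-factor {g} (s≤s (s≤s z≤n))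
  ... | p , p-prime , p∣g with avoid p p-prime (∣-trans p∣g g∣n)
  ... | m , p∤m , m∈S = rec h<g h≢0 (∣-trans (gcd[m,n]∣m g m) g∣n) (closed g∈S m∈S)
    where
    h : ℕ
    h = gcd g m
    h≢0 : h ≢ 0
    h≢0 = gcd[m,n]≢0 g m (inj₁ λ ())
    h≢g : h ≢ g
    h≢g h≡g = p∤m (∣-trans p∣g (≡.subst (_∣ m) h≡g (gcd[m,n]∣n g m)))
    h<g : h < g
    h<g = ℕ.≤∧≢⇒< (∣⇒≤ (gcd[m,n]∣m g m)) h≢g

-- Counting and the Möbius function

module _ {ℓ} {P : Pred ℕ ℓ} (P? : Decidable P) where

  count : ℕ → ℕ
  count N = length (filter P? (upTo N))

  count-suc : ∀ N → count (suc N) ≡ count N ℕ.+ length (filter P? (N ∷ []))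
  count-suc N = begin
    length (filter P? (upTo (suc N)))                  ≡⟨ cong (length ∘ filter P?) (List.upTo-∷ʳ N) ⟨
    length (filter P? (upTo N ++ N ∷ []))              ≡⟨ cong length (List.filter-++ P? (upTo N) (N ∷ [])) ⟩
    length (filter P? (upTo N) ++ filter P? (N ∷ []))  ≡⟨ List.length-++ (filter P? (upTo N)) ⟩
    count N ℕ.+ length (filter P? (N ∷ []))            ∎
    where open ≡.≡-Reasoning

  count-accept : ∀ {N} → P N → count (suc N) ≡ suc (count N)
  count-accept {N} PN = ≡.trans (count-suc N)
    (≡.trans (cong (λ xs → count N ℕ.+ length xs) (List.filter-accept P? PN)) (ℕ.+-comm (count N) 1))

  count-reject : ∀ {N} → ¬ P N → count (suc N) ≡ count N
  count-reject {N} ¬PN = ≡.trans (count-suc N)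
    (≡.trans (cong (λ xs → count N ℕ.+ length xs) (List.filter-reject P? ¬PN)) (ℕ.+-identityʳ (count N)))

  count-extend : ∀ {N N′} → (∀ {x} → P x → x < N) → N ≤ N′ → count N′ ≡ count N
  count-extend {N} P<N N≤N′ = go (ℕ.≤⇒≤′ N≤N′)
    where
    go : ∀ {N′} → N ≤′ N′ → count N′ ≡ count N
    go (≤′-reflexive refl) = refl
    go (≤′-step N≤′N′)     =
      ≡.trans (count-reject λ PN′ → ℕ.<⇒≱ (P<N PN′) (ℕ.≤′⇒≤ N≤′N′)) (go N≤′N′)

module _ {ℓ ℓ′} {P : Pred ℕ ℓ} {Q : Pred ℕ ℓ′} (P? : Decidable P) (Q? : Decidable Q) where

  count-cong : ∀ N → (∀ {x} → x < N → P x → Q x) → (∀ {x} → x < N → Q x → P x) →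
               count P? N ≡ count Q? N
  count-cong zero    _   _   = refl
  count-cong (suc N) P→Q Q→P
    with count-cong N (λ x<N → P→Q (ℕ.m<n⇒m<1+n x<N)) (λ x<N → Q→P (ℕ.m<n⇒m<1+n x<N)) | P? N
  ... | ih | yes PN =
    ≡.trans (count-accept P? PN) (≡.trans (cong suc ih) (≡.sym (count-accept Q? (P→Q ℕ.≤-refl PN))))
  ... | ih | no ¬PN =
    ≡.trans (count-reject P? ¬PN) (≡.trans ih (≡.sym (count-reject Q? (¬PN ∘ Q→P ℕ.≤-refl))))

  count-insert : ∀ {p N} → (∀ {x} → P x → Q x) → (∀ {x} → Q x → P x ⊎ x ≡ p) →
                 Q p → ¬ P p → p < N → count Q? N ≡ suc (count P? N)
  count-insert {p} P→Q Q→P∪p Qp ¬Pp p<N = go (ℕ.≤⇒≤′ p<N)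
    where
    Q→P-below : ∀ {x} → x < p → Q x → P x
    Q→P-below x<p Qx with Q→P∪p Qx
    ... | inj₁ Px   = Px
    ... | inj₂ refl = contradiction x<p (ℕ.<-irrefl refl)

    ¬Q-above : ∀ {x} → p < x → ¬ P x → ¬ Q x
    ¬Q-above p<x ¬Px Qx with Q→P∪p Qx
    ... | inj₁ Px   = ¬Px Px
    ... | inj₂ refl = ℕ.<-irrefl refl p<x

    go : ∀ {N} → suc p ≤′ N → count Q? N ≡ suc (count P? N)
    go (≤′-reflexive refl) = begin
      count Q? (suc p)        ≡⟨ count-accept Q? Qp ⟩
      suc (count Q? p)        ≡⟨ cong suc (count-cong p (λ _ → P→Q) Q→P-below) ⟨
      suc (count P? p)        ≡⟨ cong suc (count-reject P? ¬Pp) ⟨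
      suc (count P? (suc p))  ∎
      where open ≡.≡-Reasoning
    go (≤′-step {N} p<′N) with P? N
    ... | yes PN = ≡.trans (count-accept Q? (P→Q PN))
                           (cong suc (≡.trans (go p<′N) (≡.sym (count-accept P? PN))))
    ... | no ¬PN = ≡.trans (count-reject Q? (¬Q-above (ℕ.≤′⇒≤ p<′N) ¬PN))
                           (≡.trans (go p<′N) (cong suc (≡.sym (count-reject P? ¬PN))))

SquareFree : ℕ → Set
SquareFree n = ∀ {k} → 2 ≤ k → ¬ k * k ∣ n

∈-squareDivisors⁺ : ∀ {n k} → .{{_ : NonZero n}} → 2 ≤ k → k * k ∣ n → k ∈ squareDivisors n
∈-squareDivisors⁺ {k = 1} (s≤s ())
∈-squareDivisors⁺ {n} {k@(suc (suc j))} _ kk∣n =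
  ∈-filter⁺ (λ k → (k * k) ∣? n) (∈-map⁺ (λ j → suc (suc j)) (∈-upTo⁺ j<n)) kk∣n
  where
  j<n : j < n
  j<n = ℕ.<⇒≤ (ℕ.≤-trans (ℕ.m≤m*n k k) (∣⇒≤ kk∣n))

∈-squareDivisors⁻ : ∀ {n k} → k ∈ squareDivisors n → 2 ≤ k × k * k ∣ n
∈-squareDivisors⁻ {n} k∈ with ∈-filter⁻ (λ k → (k * k) ∣? n) {xs = map (λ j → suc (suc j)) (upTo n)} k∈
... | k∈map , kk∣n with ∈-map⁻ (λ j → suc (suc j)) k∈map
... | _ , _ , refl = s≤s (s≤s z≤n) , kk∣n

squareFree? : ∀ n → .{{_ : NonZero n}} → SquareFree n ⊎ ∃ λ k → 2 ≤ k × k * k ∣ n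
squareFree? n with squareDivisors n in eq
... | []    = inj₁ λ k≥2 kk∣n → ∉[] (≡.subst (_ ∈_) eq (∈-squareDivisors⁺ k≥2 kk∣n))
... | k ∷ _ = inj₂ (k , ∈-squareDivisors⁻ (≡.subst (k ∈_) (≡.sym eq) (here refl)))

μ-squareful : ∀ {n k} → .{{_ : NonZero n}} → 2 ≤ k → k * k ∣ n → μ n ≡ + 0
μ-squareful {n} k≥2 kk∣n = μ≡0 (∈-squareDivisors⁺ k≥2 kk∣n)
  where
  μ≡0 : ∀ {k} → k ∈ squareDivisors n → μ n ≡ + 0
  μ≡0 k∈ with squareDivisors n
  μ≡0 () | []
  ... | _ ∷ _ = refl

μ-squareFree : ∀ {n} → SquareFree n → μ n ≡ negOnePow (length (primeDivisors n))
μ-squareFree {n} sf with squareDivisors n in eq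
... | []    = refl
... | k ∷ _ with ∈-squareDivisors⁻ (≡.subst (k ∈_) (≡.sym eq) (here refl))
...   | k≥2 , kk∣n = contradiction kk∣n (sf k≥2)

prime²∣*prime : ∀ {ℓ p e} → Prime ℓ → Prime p → ℓ * ℓ ∣ e * p → ℓ * ℓ ∣ e ⊎ p ∣ e
prime²∣*prime {ℓ} {p} {e} ℓ-prime p-prime ℓℓ∣ep
  with euclidsLemma e p ℓ-prime (∣-trans (m∣m*n ℓ) ℓℓ∣ep)
... | inj₂ ℓ∣p rewrite ∣prime⇒≡ ℓ-prime p-prime ℓ∣p =
  inj₂ (*-cancelʳ-∣ p {{prime⇒nonZero p-prime}} ℓℓ∣ep)
... | inj₁ (divides c refl) with euclidsLemma c p ℓ-prime ℓ∣cp
  where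
  reorder : ∀ x y z → x * y * z ≡ x * z * y
  reorder = solve-ℕ
  ℓ∣cp : ℓ ∣ c * p
  ℓ∣cp = *-cancelʳ-∣ ℓ {{prime⇒nonZero ℓ-prime}} (≡.subst (ℓ * ℓ ∣_) (reorder c ℓ p) ℓℓ∣ep)
...   | inj₁ ℓ∣c = inj₁ (*-monoˡ-∣ ℓ ℓ∣c)
...   | inj₂ ℓ∣p rewrite ∣prime⇒≡ ℓ-prime p-prime ℓ∣p = inj₂ (n∣m*n c)

squareFree-*-prime : ∀ {e p} → SquareFree e → Prime p → ¬ p ∣ e → SquareFree (e * p)
squareFree-*-prime sf p-prime p∤e k≥2 kk∣ep with prime-factor k≥2
... | ℓ , ℓ-prime , ℓ∣k with prime²∣*prime ℓ-prime p-prime (∣-trans (*-pres-∣ ℓ∣k ℓ∣k) kk∣ep)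
...   | inj₁ ℓℓ∣e = sf (ℕ.nonTrivial⇒n>1 _ {{prime⇒nonTrivial ℓ-prime}}) ℓℓ∣e
...   | inj₂ p∣e  = p∤e p∣e

length-primeDivisors-*-prime : ∀ {e p} → .{{_ : NonZero e}} → Prime p → ¬ p ∣ e →
                               length (primeDivisors (e * p)) ≡ suc (length (primeDivisors e))
length-primeDivisors-*-prime {e} {p} p-prime p∤e = begin
  count Q? (suc (e * p))
    ≡⟨ count-insert P? Q? P→Q Q→P∪p (p-prime , n∣m*n e) (p∤e ∘ proj₂) p<1+ep ⟩
  suc (count P? (suc (e * p)))
    ≡⟨ cong suc (count-extend P? (λ Px → s≤s (∣⇒≤ (proj₂ Px))) 1+e≤1+ep) ⟩
  suc (count P? (suc e))
    ∎
  where
  open ≡.≡-Reasoning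
  P? : Decidable (λ x → Prime x × x ∣ e)
  P? x = prime? x ×-dec (x ∣? e)
  Q? : Decidable (λ x → Prime x × x ∣ e * p)
  Q? x = prime? x ×-dec (x ∣? e * p)
  P→Q : ∀ {x} → Prime x × x ∣ e → Prime x × x ∣ e * p
  P→Q (x-prime , x∣e) = x-prime , ∣m⇒∣m*n p x∣e
  Q→P∪p : ∀ {x} → Prime x × x ∣ e * p → (Prime x × x ∣ e) ⊎ x ≡ p
  Q→P∪p (x-prime , x∣ep) with euclidsLemma e p x-prime x∣ep
  ... | inj₁ x∣e = inj₁ (x-prime , x∣e)
  ... | inj₂ x∣p = inj₂ (∣prime⇒≡ x-prime p-prime x∣p)
  p<1+ep : p < suc (e * p)
  p<1+ep = s≤s (ℕ.m≤n*m p e)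
  1+e≤1+ep : suc e ≤ suc (e * p)
  1+e≤1+ep = s≤s (ℕ.m≤m*n e p {{prime⇒nonZero p-prime}})

μ-*-prime : ∀ {e p} → .{{_ : NonZero e}} → Prime p → ¬ p ∣ e → μ (e * p) ≡ - μ e
μ-*-prime {e} {p} p-prime p∤e with squareFree? e
... | inj₂ (k , k≥2 , kk∣e) =
  ≡.trans (μ-squareful {{ℕ.m*n≢0 e p}} k≥2 (∣m⇒∣m*n p kk∣e))
          (cong -_ (≡.sym (μ-squareful k≥2 kk∣e)))
  where
  instance
    p≢0 : NonZero p
    p≢0 = prime⇒nonZero p-prime
... | inj₁ sf = begin
  μ (e * p)                                     ≡⟨ μ-squareFree (squareFree-*-prime sf p-prime p∤e) ⟩
  negOnePow (length (primeDivisors (e * p)))    ≡⟨ cong negOnePow (length-primeDivisors-*-prime p-prime p∤e) ⟩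
  - negOnePow (length (primeDivisors e))        ≡⟨ cong -_ (μ-squareFree sf) ⟨
  - μ e                                         ∎
  where open ≡.≡-Reasoning

-- Finite sums in a commutative monoid

module FiniteSums {c ℓ} (M : CommutativeMonoid c ℓ) where

  open CommutativeMonoid M renaming (refl to ≈-refl; sym to ≈-sym; trans to ≈-trans; reflexive to ≈-reflexive)
  open import Algebra.Properties.CommutativeSemigroup commutativeSemigroup using (interchange)
  open import Relation.Binary.Reasoning.Setoid setoid

  sumTo : ℕ → (ℕ → Carrier) → Carrier
  sumTo zero    F = ε
  sumTo (suc N) F = sumTo N F ∙ F (suc N)

  sumTo-cong : ∀ N {F G} → (∀ k → k < N → F (suc k) ≈ G (suc k)) → sumTo N F ≈ sumTo N G
  sumTo-cong zero    F≈G = ≈-refl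
  sumTo-cong (suc N) F≈G = ∙-cong (sumTo-cong N λ k k<N → F≈G k (ℕ.m<n⇒m<1+n k<N)) (F≈G N ℕ.≤-refl)

  sumTo-ε : ∀ N {F} → (∀ k → k < N → F (suc k) ≈ ε) → sumTo N F ≈ ε
  sumTo-ε zero    F≈ε = ≈-refl
  sumTo-ε (suc N) F≈ε =
    ≈-trans (∙-cong (sumTo-ε N λ k k<N → F≈ε k (ℕ.m<n⇒m<1+n k<N)) (F≈ε N ℕ.≤-refl)) (identityˡ ε)

  sumTo-∙ : ∀ N F G → sumTo N (λ d → F d ∙ G d) ≈ sumTo N F ∙ sumTo N G
  sumTo-∙ zero    F G = ≈-sym (identityˡ ε)
  sumTo-∙ (suc N) F G = ≈-trans (∙-cong (sumTo-∙ N F G) ≈-refl) (interchange _ _ (F (suc N)) (G (suc N)))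

  sumTo-+ : ∀ a b F → sumTo (a ℕ.+ b) F ≈ sumTo a F ∙ sumTo b (λ d → F (a ℕ.+ d))
  sumTo-+ a zero    F =
    ≡.subst (λ n → sumTo n F ≈ sumTo a F ∙ ε) (≡.sym (ℕ.+-identityʳ a)) (≈-sym (identityʳ _))
  sumTo-+ a (suc b) F = begin
    sumTo (a ℕ.+ suc b) F                  ≡⟨ cong (λ n → sumTo n F) (ℕ.+-suc a b) ⟩
    sumTo (a ℕ.+ b) F ∙ F (suc (a ℕ.+ b))  ≈⟨ ∙-cong (sumTo-+ a b F) ≈-refl ⟩
    (sumTo a F ∙ G b) ∙ F (suc (a ℕ.+ b))  ≈⟨ assoc _ _ _ ⟩
    sumTo a F ∙ (G b ∙ F (suc (a ℕ.+ b)))  ≡⟨ cong (λ x → sumTo a F ∙ (G b ∙ F x)) (ℕ.+-suc a b) ⟨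
    sumTo a F ∙ G (suc b)                  ∎
    where
    G : ℕ → Carrier
    G b = sumTo b (λ d → F (a ℕ.+ d))

  sumTo-extend : ∀ {N N′} F → N ≤ N′ → (∀ d → N < d → d ≤ N′ → F d ≈ ε) →
                 sumTo N′ F ≈ sumTo N F
  sumTo-extend {N} F N≤N′ = go (ℕ.≤⇒≤′ N≤N′)
    where
    go : ∀ {N′} → N ≤′ N′ → (∀ d → N < d → d ≤ N′ → F d ≈ ε) → sumTo N′ F ≈ sumTo N F
    go (≤′-reflexive refl) _   = ≈-refl
    go (≤′-step N≤′N′)     F≈ε = ≈-trans
      (∙-cong (go N≤′N′ λ d N<d d≤N′ → F≈ε d N<d (ℕ.m≤n⇒m≤1+n d≤N′))
              (F≈ε _ (s≤s (ℕ.≤′⇒≤ N≤′N′)) ℕ.≤-refl))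
      (identityʳ _)

  when : ∀ {a} {A : Set a} → Dec A → Carrier → Carrier
  when (yes _) x = x
  when (no _)  _ = ε

  module _ {a} {A : Set a} where

    when-yes : ∀ (A? : Dec A) {x} → A → when A? x ≡ x
    when-yes (yes _) _ = refl
    when-yes (no ¬a) a = contradiction a ¬a

    when-no : ∀ (A? : Dec A) {x} → ¬ A → when A? x ≡ ε
    when-no (yes a) ¬a = contradiction a ¬a
    when-no (no _)  _  = refl

    when-cong : ∀ (A? : Dec A) {x y} → (A → x ≈ y) → when A? x ≈ when A? y
    when-cong (yes a) x≈y = x≈y a
    when-cong (no _)  _   = ≈-refl

    when-ε : ∀ (A? : Dec A) {x} → x ≈ ε → when A? x ≈ ε
    when-ε (yes _) x≈ε = x≈ε
    when-ε (no _)  _   = ≈-refl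

    when-∙ : ∀ (A? : Dec A) x y → when A? x ∙ when A? y ≈ when A? (x ∙ y)
    when-∙ (yes _) x y = ≈-refl
    when-∙ (no _)  x y = identityˡ ε

    when-split : ∀ (A? : Dec A) x → x ≈ when (¬? A?) x ∙ when A? x
    when-split (yes _) x = ≈-sym (identityˡ x)
    when-split (no _)  x = ≈-sym (identityʳ x)

    when-⇔ : ∀ {b} {B : Set b} (A? : Dec A) (B? : Dec B) {x} → (A → B) → (B → A) → when A? x ≡ when B? x
    when-⇔ (yes _) (yes _) _   _   = refl
    when-⇔ (yes a) (no ¬b) A→B _   = contradiction (A→B a) ¬b
    when-⇔ (no ¬a) (yes b) _   B→A = contradiction (B→A b) ¬a
    when-⇔ (no _)  (no _)  _   _   = refl

  sumTo-lastBlock : ∀ p .{{_ : NonZero p}} (K : ℕ) (F : ℕ → Carrier) →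
                    sumTo p (λ d → when (p ∣? K * p ℕ.+ d) (F (K * p ℕ.+ d))) ≈ F (K * p ℕ.+ p)
  sumTo-lastBlock p@(suc p′) K F = begin
    sumTo p′ G ∙ G p     ≈⟨ ∙-cong (sumTo-ε p′ λ k k<p′ → ≈-reflexive (when-no (p ∣? _) (p∤ k<p′)))
                                   (≈-reflexive (when-yes (p ∣? _) (∣m∣n⇒∣m+n (n∣m*n K) ∣-refl))) ⟩
    ε ∙ F (K * p ℕ.+ p)  ≈⟨ identityˡ _ ⟩
    F (K * p ℕ.+ p)      ∎
    where
    G : ℕ → Carrier
    G d = when (p ∣? K * p ℕ.+ d) (F (K * p ℕ.+ d))
    p∤ : ∀ {k} → k < p′ → ¬ p ∣ K * p ℕ.+ suc k
    p∤ k<p′ p∣ = ℕ.<⇒≱ (s≤s k<p′) (∣⇒≤ (∣m+n∣m⇒∣n p∣ (n∣m*n K)))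

  sumTo-multiples : ∀ p .{{_ : NonZero p}} (K : ℕ) (F : ℕ → Carrier) →
                    sumTo (K * p) (λ d → when (p ∣? d) (F d)) ≈ sumTo K (λ e → F (e * p))
  sumTo-multiples p zero    F = ≈-refl
  sumTo-multiples p (suc K) F = begin
    sumTo (p ℕ.+ K * p) G
      ≡⟨ cong (λ n → sumTo n G) (ℕ.+-comm p (K * p)) ⟩
    sumTo (K * p ℕ.+ p) G
      ≈⟨ sumTo-+ (K * p) p G ⟩
    sumTo (K * p) G ∙ sumTo p (λ d → G (K * p ℕ.+ d))
      ≈⟨ ∙-cong (sumTo-multiples p K F) (sumTo-lastBlock p K F) ⟩
    sumTo K (λ e → F (e * p)) ∙ F (K * p ℕ.+ p)
      ≡⟨ cong (λ n → sumTo K (λ e → F (e * p)) ∙ F n) (ℕ.+-comm (K * p) p) ⟩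
    sumTo K (λ e → F (e * p)) ∙ F (p ℕ.+ K * p)
      ∎
    where
    G : ℕ → Carrier
    G d = when (p ∣? d) (F d)

  sum-++ : ∀ xs ys → foldr _∙_ ε (xs ++ ys) ≈ foldr _∙_ ε xs ∙ foldr _∙_ ε ys
  sum-++ []       ys = ≈-sym (identityˡ _)
  sum-++ (x ∷ xs) ys = ≈-trans (∙-cong ≈-refl (sum-++ xs ys)) (≈-sym (assoc x _ _))

  -- The list index k stands for d = k + 1, as in mobiusSum.
  sum-filter-upTo : ∀ {p} {P : Pred ℕ p} (P? : Decidable P) F N →
                    foldr _∙_ ε (map (F ∘ suc) (filter (P? ∘ suc) (upTo N))) ≈
                    sumTo N (λ d → when (P? d) (F d))
  sum-filter-upTo P? F zero    = ≈-refl
  sum-filter-upTo P? F (suc N) = begin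
    Σ (filter (P? ∘ suc) (upTo (suc N)))
      ≡⟨ cong (Σ ∘ filter (P? ∘ suc)) (List.upTo-∷ʳ N) ⟨
    Σ (filter (P? ∘ suc) (upTo N ++ N ∷ []))
      ≡⟨ cong Σ (List.filter-++ (P? ∘ suc) (upTo N) (N ∷ [])) ⟩
    Σ (filter (P? ∘ suc) (upTo N) ++ filter (P? ∘ suc) (N ∷ []))
      ≡⟨ cong (foldr _∙_ ε) (List.map-++ (F ∘ suc) (filter (P? ∘ suc) (upTo N)) _) ⟩
    foldr _∙_ ε (map (F ∘ suc) (filter (P? ∘ suc) (upTo N)) ++ map (F ∘ suc) (filter (P? ∘ suc) (N ∷ [])))
      ≈⟨ sum-++ (map (F ∘ suc) (filter (P? ∘ suc) (upTo N))) _ ⟩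
    Σ (filter (P? ∘ suc) (upTo N)) ∙ Σ (filter (P? ∘ suc) (N ∷ []))
      ≈⟨ ∙-cong (sum-filter-upTo P? F N) last ⟩
    sumTo (suc N) (λ d → when (P? d) (F d))
      ∎
    where
    Σ : List ℕ → Carrier
    Σ ks = foldr _∙_ ε (map (F ∘ suc) ks)
    last : Σ (filter (P? ∘ suc) (N ∷ [])) ≈ when (P? (suc N)) (F (suc N))
    last with P? (suc N)
    ... | yes _ = identityʳ _
    ... | no  _ = ≈-refl

  divisorSum : ℕ → (ℕ → Carrier) → Carrier
  divisorSum n F = sumTo n (λ d → when (d ∣? n) (F d))

  divisorSum-cong : ∀ n {F G} → (∀ d → .{{_ : NonZero d}} → d ∣ n → F d ≈ G d) →
                    divisorSum n F ≈ divisorSum n G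
  divisorSum-cong n F≈G = sumTo-cong n λ k _ → when-cong (suc k ∣? n) (F≈G (suc k))

  divisorSum-∙ : ∀ n F G → divisorSum n (λ d → F d ∙ G d) ≈ divisorSum n F ∙ divisorSum n G
  divisorSum-∙ n F G =
    ≈-trans (sumTo-cong n λ k _ → ≈-sym (when-∙ (suc k ∣? n) (F (suc k)) (G (suc k)))) (sumTo-∙ n _ _)

  divisorSum-extend : ∀ {m N} .{{_ : NonZero m}} F → m ≤ N →
                      sumTo N (λ d → when (d ∣? m) (F d)) ≈ divisorSum m F
  divisorSum-extend {m} F m≤N =
    sumTo-extend _ m≤N λ d m<d _ → ≈-reflexive (when-no (d ∣? m) λ d∣m → ℕ.<⇒≱ m<d (∣⇒≤ d∣m))

  module _ {p} (p-prime : Prime p) {m} .{{_ : NonZero m}} (p∤m : ¬ p ∣ m) (r : ℕ) where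

    private
      instance
        p≢0 : NonZero p
        p≢0 = prime⇒nonZero p-prime

      n K : ℕ
      n = p ^ suc r * m
      K = p ^ r * m

      n≡K*p : n ≡ K * p
      n≡K*p = reorder p (p ^ r) m
        where
        reorder : ∀ x y z → x * y * z ≡ y * z * x
        reorder = solve-ℕ

      m≤K : m ≤ K
      m≤K = ℕ.m≤n*m m (p ^ r) {{ℕ.m^n≢0 p r}}

    divisorSum-prime-to-p : ∀ (F : ℕ → Carrier) →
      sumTo (K * p) (λ d → when (¬? (p ∣? d)) (when (d ∣? n) (F d))) ≈ divisorSum m F
    divisorSum-prime-to-p F =
      ≈-trans (sumTo-cong (K * p) term) (divisorSum-extend F (ℕ.≤-trans m≤K (ℕ.m≤m*n K p)))
      where
      term : ∀ k → k < K * p →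
             when (¬? (p ∣? suc k)) (when (suc k ∣? n) (F (suc k))) ≈ when (suc k ∣? m) (F (suc k))
      term k _ with p ∣? suc k
      ... | yes p∣d = ≈-reflexive (≡.sym (when-no (suc k ∣? m) λ d∣m → p∤m (∣-trans p∣d d∣m)))
      ... | no  p∤d = ≈-reflexive
        (when-⇔ (suc k ∣? n) (suc k ∣? m) (∣p^k*m⇒∣m p-prime p∤d (suc r)) (∣n⇒∣m*n (p ^ suc r)))

    divisorSum-multiples-of-p : ∀ (F : ℕ → Carrier) → (∀ k → p ∣ suc k → F (suc k * p) ≈ ε) →
      sumTo (K * p) (λ d → when (p ∣? d) (when (d ∣? n) (F d))) ≈ divisorSum m (λ d → F (d * p))
    divisorSum-multiples-of-p F F[ep]≈ε =
      ≈-trans (sumTo-multiples p K (λ d → when (d ∣? n) (F d)))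
              (≈-trans (sumTo-cong K term) (divisorSum-extend (λ d → F (d * p)) m≤K))
      where
      term : ∀ k → k < K → when (suc k * p ∣? n) (F (suc k * p)) ≈ when (suc k ∣? m) (F (suc k * p))
      term k _ with p ∣? suc k
      ... | yes p∣e = ≈-trans (when-ε (suc k * p ∣? n) (F[ep]≈ε k p∣e))
                              (≈-reflexive (≡.sym (when-no (suc k ∣? m) λ e∣m → p∤m (∣-trans p∣e e∣m))))
      ... | no  p∤e = ≈-reflexive (when-⇔ (suc k * p ∣? n) (suc k ∣? m) ep∣n⇒e∣m e∣m⇒ep∣n)
        where
        ep∣n⇒e∣m : suc k * p ∣ n → suc k ∣ m
        ep∣n⇒e∣m ep∣n = ∣p^k*m⇒∣m p-prime p∤e r (*-cancelʳ-∣ p (≡.subst (suc k * p ∣_) n≡K*p ep∣n))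
        e∣m⇒ep∣n : suc k ∣ m → suc k * p ∣ n
        e∣m⇒ep∣n e∣m = ≡.subst (suc k * p ∣_) (≡.sym n≡K*p) (*-monoˡ-∣ p (∣n⇒∣m*n (p ^ r) e∣m))

    divisorSum-split : ∀ (F : ℕ → Carrier) → (∀ k → p ∣ suc k → F (suc k * p) ≈ ε) →
                       divisorSum n F ≈ divisorSum m (λ d → F d ∙ F (d * p))
    divisorSum-split F F[ep]≈ε = begin
      sumTo n H
        ≡⟨ cong (λ N → sumTo N H) n≡K*p ⟩
      sumTo (K * p) H
        ≈⟨ sumTo-cong (K * p) (λ k _ → when-split (p ∣? suc k) (H (suc k))) ⟩
      sumTo (K * p) (λ d → when (¬? (p ∣? d)) (H d) ∙ when (p ∣? d) (H d))
        ≈⟨ sumTo-∙ (K * p) _ _ ⟩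
      sumTo (K * p) (λ d → when (¬? (p ∣? d)) (H d)) ∙ sumTo (K * p) (λ d → when (p ∣? d) (H d))
        ≈⟨ ∙-cong (divisorSum-prime-to-p F) (divisorSum-multiples-of-p F F[ep]≈ε) ⟩
      divisorSum m F ∙ divisorSum m (λ d → F (d * p))
        ≈⟨ divisorSum-∙ m F (λ d → F (d * p)) ⟨
      divisorSum m (λ d → F d ∙ F (d * p))
        ∎
      where
      H : ℕ → Carrier
      H d = when (d ∣? n) (F d)

-- The ring ℤ[q]

-- A record rather than f ≈P g itself, so that f and g can be inferred from a proof.
infix 4 _≈_
record _≈_ (f g : Poly) : Set where
  constructor coeffwise
  field coeff-≡ : f ≈P g
open _≈_

≈-isEquivalence : IsEquivalence _≈_
≈-isEquivalence = record
  { refl  = coeffwise λ _ → refl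
  ; sym   = λ f≈g → coeffwise λ i → ≡.sym (coeff-≡ f≈g i)
  ; trans = λ f≈g g≈h → coeffwise λ i → ≡.trans (coeff-≡ f≈g i) (coeff-≡ g≈h i)
  }

open IsEquivalence ≈-isEquivalence using ()
  renaming (refl to ≈-refl; sym to ≈-sym; trans to ≈-trans; reflexive to ≈-reflexive)

≈-setoid : Setoid _ _
≈-setoid = record { isEquivalence = ≈-isEquivalence }

open import Relation.Binary.Reasoning.Setoid ≈-setoid

infixr 7 _·_
_·_ : ℤ → Poly → Poly
c · f = map (c ℤ.*_) f

shift : Poly → Poly
shift f = + 0 ∷ f

constant : ℤ → Poly
constant c = c ∷ []

1P : Poly
1P = constant (+ 1)

coeff-+ : ∀ f g i → coeff (f +P g) i ≡ coeff f i ℤ.+ coeff g i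
coeff-+ []      g       i       = ≡.sym (ℤ.+-identityˡ _)
coeff-+ (c ∷ f) []      i       = ≡.sym (ℤ.+-identityʳ _)
coeff-+ (c ∷ f) (d ∷ g) zero    = refl
coeff-+ (c ∷ f) (d ∷ g) (suc i) = coeff-+ f g i

coeff-neg : ∀ f i → coeff (negP f) i ≡ ℤ.- coeff f i
coeff-neg []      i       = refl
coeff-neg (c ∷ f) zero    = refl
coeff-neg (c ∷ f) (suc i) = coeff-neg f i

coeff-· : ∀ c f i → coeff (c · f) i ≡ c ℤ.* coeff f i
coeff-· c []      i       = ≡.sym (ℤ.*-zeroʳ c)
coeff-· c (d ∷ f) zero    = refl
coeff-· c (d ∷ f) (suc i) = coeff-· c f i

∷-cong : ∀ {c d f g} → c ≡ d → f ≈ g → c ∷ f ≈ d ∷ g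
∷-cong c≡d f≈g = coeffwise λ { zero → c≡d ; (suc i) → coeff-≡ f≈g i }

∷-injective : ∀ {c d f g} → c ∷ f ≈ d ∷ g → c ≡ d × f ≈ g
∷-injective c∷f≈d∷g = coeff-≡ c∷f≈d∷g zero , coeffwise λ i → coeff-≡ c∷f≈d∷g (suc i)

[]≈∷⇒ : ∀ {c f} → [] ≈ c ∷ f → c ≡ + 0 × [] ≈ f
[]≈∷⇒ []≈c∷f = ≡.sym (coeff-≡ []≈c∷f zero) , coeffwise λ i → coeff-≡ []≈c∷f (suc i)

shift-zero : shift [] ≈ []
shift-zero = coeffwise λ { zero → refl ; (suc i) → refl }

by-coeff : ∀ {f g} {x y : ℕ → ℤ} →
           (∀ i → coeff f i ≡ x i) → (∀ i → x i ≡ y i) → (∀ i → coeff g i ≡ y i) → f ≈ g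
by-coeff f≡x x≡y g≡y = coeffwise λ i → ≡.trans (f≡x i) (≡.trans (x≡y i) (≡.sym (g≡y i)))

+-cong : ∀ {f f′ g g′} → f ≈ f′ → g ≈ g′ → f +P g ≈ f′ +P g′
+-cong {f} {f′} {g} {g′} f≈f′ g≈g′ =
  by-coeff (coeff-+ f g) (λ i → cong₂ ℤ._+_ (coeff-≡ f≈f′ i) (coeff-≡ g≈g′ i)) (coeff-+ f′ g′)

+-assoc : ∀ f g h → (f +P g) +P h ≈ f +P (g +P h)
+-assoc f g h =
  by-coeff (λ i → ≡.trans (coeff-+ (f +P g) h i) (cong (ℤ._+ coeff h i) (coeff-+ f g i)))
           (λ i → ℤ.+-assoc (coeff f i) (coeff g i) (coeff h i))
           (λ i → ≡.trans (coeff-+ f (g +P h) i) (cong₂ ℤ._+_ (refl {x = coeff f i}) (coeff-+ g h i)))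

+-comm : ∀ f g → f +P g ≈ g +P f
+-comm f g = by-coeff (coeff-+ f g) (λ i → ℤ.+-comm (coeff f i) (coeff g i)) (coeff-+ g f)

+-identityˡ : ∀ f → [] +P f ≈ f
+-identityˡ f = ≈-refl

+-identityʳ : ∀ f → f +P [] ≈ f
+-identityʳ f = by-coeff (coeff-+ f []) (λ i → ℤ.+-identityʳ (coeff f i)) (λ _ → refl)

-‿cong : ∀ {f g} → f ≈ g → negP f ≈ negP g
-‿cong {f} {g} f≈g = by-coeff (coeff-neg f) (λ i → cong ℤ.-_ (coeff-≡ f≈g i)) (coeff-neg g)

-‿inverseˡ : ∀ f → negP f +P f ≈ []
-‿inverseˡ f =
  by-coeff (λ i → ≡.trans (coeff-+ (negP f) f i) (cong (ℤ._+ coeff f i) (coeff-neg f i)))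
           (λ i → ℤ.+-inverseˡ (coeff f i)) (λ _ → refl)

-‿inverseʳ : ∀ f → f +P negP f ≈ []
-‿inverseʳ f = ≈-trans (+-comm f (negP f)) (-‿inverseˡ f)

+-isAbelianGroup : IsAbelianGroup _≈_ _+P_ [] negP
+-isAbelianGroup = record
  { isGroup = record
    { isMonoid = record
      { isSemigroup = record
        { isMagma = record { isEquivalence = ≈-isEquivalence ; ∙-cong = +-cong }
        ; assoc   = +-assoc
        }
      ; identity = +-identityˡ , +-identityʳ
      }
    ; inverse = -‿inverseˡ , -‿inverseʳ
    ; ⁻¹-cong = -‿cong
    }
  ; comm = +-comm
  }

+-abelianGroup : AbelianGroup _ _
+-abelianGroup = record { isAbelianGroup = +-isAbelianGroup }

open import Algebra.Properties.CommutativeSemigroup (AbelianGroup.commutativeSemigroup +-abelianGroup)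
  using () renaming (interchange to +-interchange; x∙yz≈y∙xz to +-leftSwap)

·-cong : ∀ c {f g} → f ≈ g → c · f ≈ c · g
·-cong c {f} {g} f≈g = by-coeff (coeff-· c f) (λ i → cong (c ℤ.*_) (coeff-≡ f≈g i)) (coeff-· c g)

·-distribˡ : ∀ c f g → c · (f +P g) ≈ c · f +P c · g
·-distribˡ c f g =
  by-coeff (λ i → ≡.trans (coeff-· c (f +P g) i) (cong (c ℤ.*_) (coeff-+ f g i)))
           (λ i → ℤ.*-distribˡ-+ c (coeff f i) (coeff g i))
           (λ i → ≡.trans (coeff-+ (c · f) (c · g) i) (cong₂ ℤ._+_ (coeff-· c f i) (coeff-· c g i)))

·-distribʳ : ∀ c d f → (c ℤ.+ d) · f ≈ c · f +P d · f
·-distribʳ c d f =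
  by-coeff (coeff-· (c ℤ.+ d) f) (λ i → ℤ.*-distribʳ-+ (coeff f i) c d)
           (λ i → ≡.trans (coeff-+ (c · f) (d · f) i) (cong₂ ℤ._+_ (coeff-· c f i) (coeff-· d f i)))

·-assoc : ∀ c d f → c · d · f ≈ (c ℤ.* d) · f
·-assoc c d f =
  by-coeff (λ i → ≡.trans (coeff-· c (d · f) i) (cong (c ℤ.*_) (coeff-· d f i)))
           (λ i → ≡.sym (ℤ.*-assoc c d (coeff f i))) (coeff-· (c ℤ.* d) f)

·-zero : ∀ f → + 0 · f ≈ []
·-zero f = by-coeff (coeff-· (+ 0) f) (λ i → ℤ.*-zeroˡ (coeff f i)) (λ _ → refl)

·-identity : ∀ f → + 1 · f ≈ f
·-identity f = by-coeff (coeff-· (+ 1) f) (λ i → ℤ.*-identityˡ (coeff f i)) (λ _ → refl)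

-- Lists that differ by trailing zeros are ≈, so a fold respects ≈ once its step does and the
-- step at a zero coefficient sends [] to [].
module FoldrCong (step : ℤ → Poly → Poly)
                 (step-congʳ : ∀ c {h h′} → h ≈ h′ → step c h ≈ step c h′)
                 (step-zero : step (+ 0) [] ≈ []) where

  foldr-≈[] : ∀ {f} → [] ≈ f → foldr step [] f ≈ []
  foldr-≈[] {[]}    _ = ≈-refl
  foldr-≈[] {c ∷ f} []≈c∷f with []≈∷⇒ []≈c∷f
  ... | refl , []≈f = ≈-trans (step-congʳ (+ 0) (foldr-≈[] []≈f)) step-zero

  foldr-cong : ∀ {f f′} → f ≈ f′ → foldr step [] f ≈ foldr step [] f′
  foldr-cong {[]}    {f′}      f≈f′ = ≈-sym (foldr-≈[] f≈f′)
  foldr-cong {c ∷ f} {[]}      f≈f′ = foldr-≈[] (≈-sym f≈f′)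
  foldr-cong {c ∷ f} {c′ ∷ f′} f≈f′ with ∷-injective f≈f′
  ... | refl , tails≈ = step-congʳ c (foldr-cong tails≈)

*-as-foldr : ∀ f g → f *P g ≡ foldr (λ c h → c · g +P shift h) [] f
*-as-foldr []      g = refl
*-as-foldr (c ∷ f) g = cong (λ h → c · g +P shift h) (*-as-foldr f g)

*-congʳ : ∀ g {f f′} → f ≈ f′ → f *P g ≈ f′ *P g
*-congʳ g {f} {f′} f≈f′ = begin
  f *P g                                  ≡⟨ *-as-foldr f g ⟩
  foldr (λ c h → c · g +P shift h) [] f   ≈⟨ foldr-cong f≈f′ ⟩
  foldr (λ c h → c · g +P shift h) [] f′  ≡⟨ *-as-foldr f′ g ⟨
  f′ *P g                                 ∎
  where
  open FoldrCong (λ c h → c · g +P shift h) (λ c h≈h′ → +-cong ≈-refl (∷-cong refl h≈h′))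
                 (+-cong (·-zero g) shift-zero)

*-zeroʳ : ∀ f → f *P [] ≈ []
*-zeroʳ []      = ≈-refl
*-zeroʳ (c ∷ f) = ≈-trans (∷-cong refl (*-zeroʳ f)) shift-zero

shift-* : ∀ f g → shift f *P g ≈ shift (f *P g)
shift-* f g = +-cong (·-zero g) ≈-refl

*-distribʳ : ∀ h f g → (f +P g) *P h ≈ f *P h +P g *P h
*-distribʳ h []      g       = ≈-refl
*-distribʳ h (c ∷ f) []      = ≈-sym (+-identityʳ _)
*-distribʳ h (c ∷ f) (d ∷ g) = begin
  (c ℤ.+ d) · h +P shift ((f +P g) *P h)
    ≈⟨ +-cong (·-distribʳ c d h) (∷-cong refl (*-distribʳ h f g)) ⟩
  (c · h +P d · h) +P (shift (f *P h) +P shift (g *P h))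
    ≈⟨ +-interchange (c · h) (d · h) _ _ ⟩
  (c · h +P shift (f *P h)) +P (d · h +P shift (g *P h))
    ∎

*-∷ʳ : ∀ f d g → f *P (d ∷ g) ≈ d · f +P shift (f *P g)
*-∷ʳ []      d g = ≈-sym shift-zero
*-∷ʳ (c ∷ f) d g = ∷-cong (cong (ℤ._+ + 0) (ℤ.*-comm c d)) (begin
  c · g +P f *P (d ∷ g)               ≈⟨ +-cong ≈-refl (*-∷ʳ f d g) ⟩
  c · g +P (d · f +P shift (f *P g))  ≈⟨ +-leftSwap (c · g) (d · f) _ ⟩
  d · f +P (c · g +P shift (f *P g))  ∎)

*-comm : ∀ f g → f *P g ≈ g *P f
*-comm []      g = ≈-sym (*-zeroʳ g)
*-comm (c ∷ f) g = ≈-trans (+-cong ≈-refl (∷-cong refl (*-comm f g))) (≈-sym (*-∷ʳ g c f))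

*-congˡ : ∀ f {g g′} → g ≈ g′ → f *P g ≈ f *P g′
*-congˡ f {g} {g′} g≈g′ = ≈-trans (*-comm f g) (≈-trans (*-congʳ f g≈g′) (*-comm g′ f))

*-cong : ∀ {f f′ g g′} → f ≈ f′ → g ≈ g′ → f *P g ≈ f′ *P g′
*-cong {f′ = f′} {g = g} f≈f′ g≈g′ = ≈-trans (*-congʳ g f≈f′) (*-congˡ f′ g≈g′)

*-distribˡ : ∀ f g h → f *P (g +P h) ≈ f *P g +P f *P h
*-distribˡ f g h = ≈-trans (*-comm f _) (≈-trans (*-distribʳ f g h) (+-cong (*-comm g f) (*-comm h f)))

·-*-assoc : ∀ c f g → c · (f *P g) ≈ (c · f) *P g
·-*-assoc c []      g = ≈-refl
·-*-assoc c (d ∷ f) g =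
  ≈-trans (·-distribˡ c (d · g) _) (+-cong (·-assoc c d g) (∷-cong (ℤ.*-zeroʳ c) (·-*-assoc c f g)))

*-assoc : ∀ f g h → (f *P g) *P h ≈ f *P (g *P h)
*-assoc []      g h = ≈-refl
*-assoc (c ∷ f) g h = begin
  (c · g +P shift (f *P g)) *P h         ≈⟨ *-distribʳ h (c · g) _ ⟩
  (c · g) *P h +P shift (f *P g) *P h    ≈⟨ +-cong (≈-sym (·-*-assoc c g h)) (shift-* (f *P g) h) ⟩
  c · (g *P h) +P shift ((f *P g) *P h)  ≈⟨ +-cong ≈-refl (∷-cong refl (*-assoc f g h)) ⟩
  c · (g *P h) +P shift (f *P (g *P h))  ∎

*-identityˡ : ∀ f → 1P *P f ≈ f
*-identityˡ f = ≈-trans (+-cong (·-identity f) shift-zero) (+-identityʳ f)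

*-identityʳ : ∀ f → f *P 1P ≈ f
*-identityʳ f = ≈-trans (*-comm f 1P) (*-identityˡ f)

ℤ[q] : CommutativeRing _ _
ℤ[q] = record
  { Carrier = Poly ; _≈_ = _≈_ ; _+_ = _+P_ ; _*_ = _*P_ ; -_ = negP ; 0# = [] ; 1# = 1P
  ; isCommutativeRing = record
    { isRing = record
      { +-isAbelianGroup = +-isAbelianGroup
      ; *-cong           = *-cong
      ; *-assoc          = *-assoc
      ; *-identity       = *-identityˡ , *-identityʳ
      ; distrib          = *-distribˡ , *-distribʳ
      }
    ; *-comm = *-comm
    }
  }

-- The ring solver only cancels a monomial whose coefficient it can recognise as zero.
ℤ[q]ᵃ : AlmostCommutativeRing _ _
ℤ[q]ᵃ = fromCommutativeRing ℤ[q] ≈[]?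
  where
  ≈[]? : ∀ f → Maybe ([] ≈ f)
  ≈[]? []      = just ≈-refl
  ≈[]? (c ∷ f) with c ℤ.≟ + 0 | ≈[]? f
  ... | yes refl | just []≈f = just (≈-trans (≈-sym shift-zero) (∷-cong refl []≈f))
  ... | _        | _         = nothing

open import Algebra.Properties.Ring (CommutativeRing.ring ℤ[q]) using (-‿distribˡ-*)
open import Algebra.Properties.Group (CommutativeRing.+-group ℤ[q]) using (inverseˡ-unique)
open import Algebra.Properties.Semiring.Divisibility (CommutativeRing.semiring ℤ[q])
  using (_,_)
  renaming (_∣_ to _∣P_; ∣ʳ-trans to ∣P-trans; ∣ʳ-respʳ-≈ to ∣P-respʳ; ∣ʳ-respˡ-≈ to ∣P-respˡ;
            x∣ʳy⇒x∣ʳzy to ∣P-*ˡ)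
open import Algebra.Properties.CommutativeSemigroup.Divisibility (CommutativeRing.*-commutativeSemigroup ℤ[q])
  using () renaming (x∣y⇒zx∣zy to ∣P-*-monoˡ)

·≈constant* : ∀ c f → c · f ≈ constant c *P f
·≈constant* c f = ≈-sym (≈-trans (+-cong ≈-refl shift-zero) (+-identityʳ (c · f)))

*-·-comm : ∀ c f g → f *P (c · g) ≈ c · (f *P g)
*-·-comm c f g = begin
  f *P (c · g)  ≈⟨ *-comm f (c · g) ⟩
  (c · g) *P f  ≈⟨ ·-*-assoc c g f ⟨
  c · (g *P f)  ≈⟨ ·-cong c (*-comm g f) ⟩
  c · (f *P g)  ∎

∣P-+ : ∀ {N f g} → N ∣P f → N ∣P g → N ∣P f +P g
∣P-+ {N} (k , kN≈f) (l , lN≈g) = k +P l , ≈-trans (*-distribʳ N k l) (+-cong kN≈f lN≈g)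

∣P-neg : ∀ {N f} → N ∣P f → N ∣P negP f
∣P-neg {N} (k , kN≈f) = negP k , ≈-trans (≈-sym (-‿distribˡ-* k N)) (-‿cong kN≈f)

∣P-- : ∀ {N f g} → N ∣P f → N ∣P g → N ∣P f -P g
∣P-- N∣f N∣g = ∣P-+ N∣f (∣P-neg N∣g)

∣P-+-cancelʳ : ∀ {N f g} → N ∣P f +P g → N ∣P g → N ∣P f
∣P-+-cancelʳ {f = f} {g} N∣f+g N∣g = ∣P-respʳ (cancel f g) (∣P-- N∣f+g N∣g)
  where
  cancel : ∀ x y → (x +P y) +P negP y ≈ x
  cancel = solve-∀ ℤ[q]ᵃ

∣P-· : ∀ {N f} c → N ∣P f → N ∣P c · f
∣P-· {f = f} c N∣f = ∣P-respʳ (≈-sym (·≈constant* c f)) (∣P-*ˡ (constant c) N∣f)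

modP⇒∣P : ∀ f g {N} → f ≡ g [modP N ] → N ∣P f -P g
modP⇒∣P f g {N} (k , f-g≈Nk) = k , ≈-trans (*-comm k N) (≈-sym (coeffwise f-g≈Nk))

∣P⇒modP : ∀ f g {N} → N ∣P f -P g → f ≡ g [modP N ]
∣P⇒modP f g {N} (k , kN≈f-g) = k , coeff-≡ (≈-trans (≈-sym kN≈f-g) (*-comm k N))

-- Substitution q ↦ q^d and q-integers

compose-congˡ : ∀ g {f f′} → f ≈ f′ → compose f g ≈ compose f′ g
compose-congˡ g = foldr-cong
  where
  open FoldrCong (λ c h → constant c +P g *P h) (λ c h≈h′ → +-cong ≈-refl (*-congˡ g h≈h′))
                 (+-cong shift-zero (*-zeroʳ g))

compose-congʳ : ∀ f {g g′} → g ≈ g′ → compose f g ≈ compose f g′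
compose-congʳ []      g≈g′ = ≈-refl
compose-congʳ (c ∷ f) g≈g′ = +-cong ≈-refl (*-cong g≈g′ (compose-congʳ f g≈g′))

compose-constant : ∀ c g → compose (constant c) g ≈ constant c
compose-constant c g = ≈-trans (+-cong ≈-refl (*-zeroʳ g)) (+-identityʳ _)

compose-shift : ∀ f g → compose (shift f) g ≈ g *P compose f g
compose-shift f g = +-cong shift-zero ≈-refl

compose-+ : ∀ g f h → compose (f +P h) g ≈ compose f g +P compose h g
compose-+ g []      h       = ≈-refl
compose-+ g (c ∷ f) []      = ≈-sym (+-identityʳ _)
compose-+ g (c ∷ f) (d ∷ h) = begin
  constant (c ℤ.+ d) +P g *P compose (f +P h) g
    ≈⟨ +-cong ≈-refl (≈-trans (*-congˡ g (compose-+ g f h)) (*-distribˡ g _ _)) ⟩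
  (constant c +P constant d) +P (g *P compose f g +P g *P compose h g)
    ≈⟨ +-interchange (constant c) (constant d) (g *P compose f g) (g *P compose h g) ⟩
  compose (c ∷ f) g +P compose (d ∷ h) g
    ∎

compose-neg : ∀ g f → compose (negP f) g ≈ negP (compose f g)
compose-neg g f = inverseˡ-unique _ _ (begin
  compose (negP f) g +P compose f g  ≈⟨ compose-+ g (negP f) f ⟨
  compose (negP f +P f) g            ≈⟨ compose-congˡ g (-‿inverseˡ f) ⟩
  []                                 ∎)

compose-· : ∀ g c f → compose (c · f) g ≈ c · compose f g
compose-· g c []      = ≈-refl
compose-· g c (d ∷ f) = begin
  constant (c ℤ.* d) +P g *P compose (c · f) g  ≈⟨ +-cong ≈-refl (*-congˡ g (compose-· g c f)) ⟩
  constant (c ℤ.* d) +P g *P (c · compose f g)  ≈⟨ +-cong ≈-refl (*-·-comm c g _) ⟩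
  c · constant d +P c · (g *P compose f g)      ≈⟨ ·-distribˡ c (constant d) (g *P compose f g) ⟨
  c · compose (d ∷ f) g                         ∎

compose-* : ∀ g f h → compose (f *P h) g ≈ compose f g *P compose h g
compose-* g []      h = ≈-refl
compose-* g (c ∷ f) h = begin
  compose (c · h +P shift (f *P h)) g              ≈⟨ compose-+ g (c · h) _ ⟩
  compose (c · h) g +P compose (shift (f *P h)) g  ≈⟨ +-cong (compose-· g c h) (compose-shift (f *P h) g) ⟩
  c · H +P g *P compose (f *P h) g                 ≈⟨ +-cong (·≈constant* c H) (*-congˡ g (compose-* g f h)) ⟩
  constant c *P H +P g *P (compose f g *P H)       ≈⟨ +-cong ≈-refl (*-assoc g _ H) ⟨
  constant c *P H +P (g *P compose f g) *P H       ≈⟨ *-distribʳ H (constant c) (g *P compose f g) ⟨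
  compose (c ∷ f) g *P H                           ∎
  where
  H : Poly
  H = compose h g

compose-assoc : ∀ f g h → compose (compose f g) h ≈ compose f (compose g h)
compose-assoc []      g h = ≈-refl
compose-assoc (c ∷ f) g h = begin
  compose (constant c +P g *P compose f g) h
    ≈⟨ compose-+ h (constant c) (g *P compose f g) ⟩
  compose (constant c) h +P compose (g *P compose f g) h
    ≈⟨ +-cong (compose-constant c h) (compose-* h g _) ⟩
  constant c +P compose g h *P compose (compose f g) h
    ≈⟨ +-cong ≈-refl (*-congˡ (compose g h) (compose-assoc f g h)) ⟩
  constant c +P compose g h *P compose f (compose g h)
    ∎

monomial-+ : ∀ a b → monomial (a ℕ.+ b) ≈ monomial a *P monomial b
monomial-+ zero    b = ≈-sym (*-identityˡ _)
monomial-+ (suc a) b = ≈-trans (∷-cong refl (monomial-+ a b)) (≈-sym (shift-* (monomial a) (monomial b)))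

compose-monomial : ∀ e d → compose (monomial e) (monomial d) ≈ monomial (e * d)
compose-monomial zero    d = compose-constant (+ 1) (monomial d)
compose-monomial (suc e) d = begin
  compose (shift (monomial e)) (monomial d)        ≈⟨ compose-shift (monomial e) (monomial d) ⟩
  monomial d *P compose (monomial e) (monomial d)  ≈⟨ *-congˡ (monomial d) (compose-monomial e d) ⟩
  monomial d *P monomial (e * d)                   ≈⟨ monomial-+ d (e * d) ⟨
  monomial (d ℕ.+ e * d)                           ∎

subst-cong : ∀ d {f g} → f ≈ g → subst d f ≈ subst d g
subst-cong d = compose-congˡ (monomial d)

subst-- : ∀ d f g → subst d (f -P g) ≈ subst d f -P subst d g
subst-- d f g = ≈-trans (compose-+ (monomial d) f (negP g)) (+-cong ≈-refl (compose-neg (monomial d) g))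

subst-* : ∀ d f g → subst d (f *P g) ≈ subst d f *P subst d g
subst-* d = compose-* (monomial d)

subst-subst : ∀ d e f → subst d (subst e f) ≈ subst (e * d) f
subst-subst d e f =
  ≈-trans (compose-assoc f (monomial e) (monomial d)) (compose-congʳ f (compose-monomial e d))

subst-1 : ∀ f → subst 1 f ≈ f
subst-1 []      = ≈-refl
subst-1 (c ∷ f) = begin
  constant c +P monomial 1 *P subst 1 f  ≈⟨ +-cong (≈-refl {constant c}) (shift-* 1P (subst 1 f)) ⟩
  constant c +P shift (1P *P subst 1 f)  ≈⟨ +-cong (≈-refl {constant c}) (∷-cong refl (*-identityˡ _)) ⟩
  constant c +P shift (subst 1 f)        ≈⟨ ∷-cong (ℤ.+-identityʳ c) (subst-1 f) ⟩
  c ∷ f                                  ∎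

subst-∣P : ∀ d {N f} → N ∣P f → subst d N ∣P subst d f
subst-∣P d {N} (k , kN≈f) = subst d k , ≈-trans (≈-sym (subst-* d k N)) (subst-cong d kN≈f)

qInt-+ : ∀ a b → qInt (a ℕ.+ b) ≈ qInt a +P monomial a *P qInt b
qInt-+ zero    b = ≈-sym (*-identityˡ _)
qInt-+ (suc a) b =
  ≈-trans (∷-cong refl (qInt-+ a b)) (+-cong (≈-refl {qInt (suc a)}) (≈-sym (shift-* (monomial a) (qInt b))))

qInt-* : ∀ m k → qInt (m * k) ≈ qInt m *P subst m (qInt k)
qInt-* m zero    = ≈-trans (≈-reflexive (cong qInt (ℕ.*-zeroʳ m))) (≈-sym (*-zeroʳ (qInt m)))
qInt-* m (suc k) = begin
  qInt (m * suc k)                                      ≡⟨ cong qInt (ℕ.*-suc m k) ⟩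
  qInt (m ℕ.+ m * k)                                    ≈⟨ qInt-+ m (m * k) ⟩
  qInt m +P monomial m *P qInt (m * k)                  ≈⟨ +-cong ≈-refl (*-congˡ (monomial m) (qInt-* m k)) ⟩
  qInt m +P monomial m *P (qInt m *P subst m (qInt k))  ≈⟨ factor (qInt m) (monomial m) (subst m (qInt k)) ⟩
  qInt m *P (1P +P monomial m *P subst m (qInt k))      ∎
  where
  factor : ∀ a x s → a +P x *P (a *P s) ≈ a *P (1P +P x *P s)
  factor = solve-∀ ℤ[q]ᵃ

qInt-*ʳ : ∀ k m → qInt (k * m) ≈ qInt m *P subst m (qInt k)
qInt-*ʳ k m = ≈-trans (≈-reflexive (cong qInt (ℕ.*-comm k m))) (qInt-* m k)

module _ {N f : Poly} where

  ∣qInt*-+-cancel : ∀ a b {c} → a ℕ.+ b ≡ c → N ∣P qInt c *P f → N ∣P qInt b *P f → N ∣P qInt a *P f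
  ∣qInt*-+-cancel a b refl N∣[c]f N∣[b]f =
    ∣P-respʳ (≈-sym [a]f≈) (∣P-- N∣[c]f (∣P-*ˡ (monomial a) N∣[b]f))
    where
    split : ∀ A X B g → A *P g ≈ (A +P X *P B) *P g +P negP (X *P (B *P g))
    split = solve-∀ ℤ[q]ᵃ
    [a]f≈ : qInt a *P f ≈ qInt (a ℕ.+ b) *P f -P monomial a *P (qInt b *P f)
    [a]f≈ = ≈-trans (split (qInt a) (monomial a) (qInt b) f) (+-cong (*-congʳ f (≈-sym (qInt-+ a b))) ≈-refl)

  ∣qInt*-* : ∀ j k → N ∣P qInt k *P f → N ∣P qInt (j * k) *P f
  ∣qInt*-* j k N∣[k]f = ∣P-respʳ (≈-sym [jk]f≈) (∣P-*ˡ (subst k (qInt j)) N∣[k]f)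
    where
    reassoc : ∀ A S g → (A *P S) *P g ≈ S *P (A *P g)
    reassoc = solve-∀ ℤ[q]ᵃ
    [jk]f≈ : qInt (j * k) *P f ≈ subst k (qInt j) *P (qInt k *P f)
    [jk]f≈ = ≈-trans (*-congʳ f (qInt-*ʳ j k)) (reassoc (qInt k) (subst k (qInt j)) f)

  qInt*-gcdClosed : GcdClosed (λ k → N ∣P qInt k *P f)
  qInt*-gcdClosed {a} {b} N∣[a]f N∣[b]f with Bézout.identity (gcd-GCD a b)
  ... | Bézout.+- x y g+yb≡xa =
    ∣qInt*-+-cancel (gcd a b) (y * b) g+yb≡xa (∣qInt*-* x a N∣[a]f) (∣qInt*-* y b N∣[b]f)
  ... | Bézout.-+ x y g+xa≡yb =
    ∣qInt*-+-cancel (gcd a b) (x * a) g+xa≡yb (∣qInt*-* y b N∣[b]f) (∣qInt*-* x a N∣[a]f)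

qInt∣-from-cofactors : ∀ {n f} → n ≢ 0 →
  (∀ p → Prime p → p ∣ n → ∃ λ m → ¬ p ∣ m × qInt n ∣P qInt m *P f) → qInt n ∣P f
qInt∣-from-cofactors {n} {f} n≢0 cofactor =
  ∣P-respʳ (*-identityˡ f) (gcdClosed⇒1∈ {S = λ k → qInt n ∣P qInt k *P f}
                                        (λ {a} {b} → qInt*-gcdClosed {a = a} {b})
                                        n≢0 (f , *-comm f (qInt n)) cofactor)

-- Möbius sums

open FiniteSums (CommutativeRing.+-commutativeMonoid ℤ[q])

-- The d-th summand of mobiusSum b n; the clause for 0 only avoids division by zero.
möbiusTerm : (ℕ → Poly) → ℕ → ℕ → Poly
möbiusTerm b n zero      = []
möbiusTerm b n d@(suc _) = μ d · subst d (b (n / d))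

möbiusTerm-nonZero : ∀ b n d .{{_ : NonZero d}} → möbiusTerm b n d ≡ μ d · subst d (b (n / d))
möbiusTerm-nonZero b n (suc _) = refl

mobiusSum≈divisorSum : ∀ b n → mobiusSum b n ≈ divisorSum n (möbiusTerm b n)
mobiusSum≈divisorSum b n = sum-filter-upTo (_∣? n) (möbiusTerm b n) n

∣P-sumTo : ∀ {N} n F → (∀ k → k < n → N ∣P F (suc k)) → N ∣P sumTo n F
∣P-sumTo zero    F N∣F = [] , ≈-refl
∣P-sumTo (suc n) F N∣F = ∣P-+ (∣P-sumTo n F λ k k<n → N∣F k (ℕ.m<n⇒m<1+n k<n)) (N∣F n ℕ.≤-refl)

∣P-when : ∀ {a} {A : Set a} {N f} (A? : Dec A) → (A → N ∣P f) → N ∣P when A? f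
∣P-when (yes a) N∣f = N∣f a
∣P-when (no _)  _   = [] , ≈-refl

∣P-divisorSum : ∀ {N} n F → (∀ d → .{{_ : NonZero d}} → d ∣ n → N ∣P F d) → N ∣P divisorSum n F
∣P-divisorSum n F N∣F = ∣P-sumTo n _ λ k _ → ∣P-when (suc k ∣? n) (N∣F (suc k))

∣P-divisorSum-head : ∀ {N} n .{{_ : NonZero n}} F → N ∣P divisorSum n F →
                     (∀ d → .{{_ : NonZero d}} → d ∣ n → 1 < d → N ∣P F d) → N ∣P F 1
∣P-divisorSum-head {N} n@(suc n′) F N∣ΣF N∣F = ∣P-+-cancelʳ N∣F1+rest N∣rest
  where
  H : ℕ → Poly
  H d = when (d ∣? n) (F d)
  N∣F1+rest : N ∣P F 1 +P sumTo n′ (λ d → H (suc d))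
  N∣F1+rest =
    ∣P-respʳ (≈-trans (sumTo-+ 1 n′ H) (+-cong (≈-reflexive (when-yes (1 ∣? n) (1∣ n))) ≈-refl)) N∣ΣF
  N∣rest : N ∣P sumTo n′ (λ d → H (suc d))
  N∣rest = ∣P-sumTo n′ _ λ k _ →
    ∣P-when (suc (suc k) ∣? n) λ d∣n → N∣F (suc (suc k)) d∣n (s≤s (s≤s z≤n))

∣P-möbiusTerm : ∀ X b {m c d} .{{_ : NonZero d}} → m ≡ c * d → subst c X ∣P b c →
                subst m X ∣P möbiusTerm b m d
∣P-möbiusTerm X b {c = c} {d} refl X∣bc =
  ≡.subst (subst (c * d) X ∣P_) (≡.sym term≡)
          (∣P-respˡ (subst-subst d c X) (∣P-· (μ d) (subst-∣P d X∣bc)))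
  where
  term≡ : möbiusTerm b (c * d) d ≡ μ d · subst d (b c)
  term≡ = ≡.trans (möbiusTerm-nonZero b (c * d) d) (cong (λ x → μ d · subst d (b x)) (m*n/n≡m c d))

∣P-mobiusSum : ∀ X b m → (∀ c → c ∣ m → subst c X ∣P b c) → subst m X ∣P mobiusSum b m
∣P-mobiusSum X b m X∣b =
  ∣P-respʳ (≈-sym (mobiusSum≈divisorSum b m)) (∣P-divisorSum m (möbiusTerm b m) term)
  where
  term : ∀ d → .{{_ : NonZero d}} → d ∣ m → subst m X ∣P möbiusTerm b m d
  term d (divides c m≡cd) = ∣P-möbiusTerm X b m≡cd (X∣b c (divides d (≡.trans m≡cd (ℕ.*-comm c d))))

∣P-mobiusSum-head : ∀ X b m .{{_ : NonZero m}} → subst m X ∣P mobiusSum b m →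
                    (∀ c → c ∣ m → c < m → subst c X ∣P b c) → subst m X ∣P b m
∣P-mobiusSum-head X b m X∣Σ X∣b =
  ∣P-respʳ first-term
    (∣P-divisorSum-head m (möbiusTerm b m) (∣P-respʳ (mobiusSum≈divisorSum b m) X∣Σ) term)
  where
  first-term : möbiusTerm b m 1 ≈ b m
  first-term = ≈-trans (·-identity _) (≈-trans (subst-1 _) (≈-reflexive (cong b (n/1≡n m))))
  term : ∀ d → .{{_ : NonZero d}} → d ∣ m → 1 < d → subst m X ∣P möbiusTerm b m d
  term d (divides c m≡cd) 1<d =
    ∣P-möbiusTerm X b m≡cd (X∣b c (divides d (≡.trans m≡cd (ℕ.*-comm c d))) c<m)
    where
    c<m : c < m
    c<m = ≡.subst (c <_) (≡.sym m≡cd) (ℕ.m<m*n c d {{ℕ.m*n≢0⇒m≢0 c {{≡.subst NonZero m≡cd it}}}} 1<d)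

defect : (ℕ → Poly) → ℕ → ℕ → ℕ → Poly
defect a p r c = a (p ^ suc r * c) -P subst p (a (p ^ r * c))

mobiusSum-p-part : ∀ a {p} → Prime p → ∀ r {m} → .{{_ : NonZero m}} → ¬ p ∣ m →
                   mobiusSum a (p ^ suc r * m) ≈ mobiusSum (defect a p r) m
mobiusSum-p-part a {p} p-prime r {m} p∤m = begin
  mobiusSum a n                                                     ≈⟨ mobiusSum≈divisorSum a n ⟩
  divisorSum n (möbiusTerm a n)                                     ≈⟨ divisorSum-split p-prime p∤m r _ squareful ⟩
  divisorSum m (λ d → möbiusTerm a n d +P möbiusTerm a n (d * p))   ≈⟨ divisorSum-cong m paired ⟩
  divisorSum m (möbiusTerm (defect a p r) m)                        ≈⟨ mobiusSum≈divisorSum (defect a p r) m ⟨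
  mobiusSum (defect a p r) m                                        ∎
  where
  instance
    p≢0 : NonZero p
    p≢0 = prime⇒nonZero p-prime
  n : ℕ
  n = p ^ suc r * m

  squareful : ∀ k → p ∣ suc k → möbiusTerm a n (suc k * p) ≈ []
  squareful k p∣e = begin
    möbiusTerm a n (suc k * p)                                ≡⟨ möbiusTerm-nonZero a n (suc k * p) ⟩
    μ (suc k * p) · f                                         ≡⟨ cong (_· f) μ[ep]≡0 ⟩
    + 0 · f                                                   ≈⟨ ·-zero f ⟩
    []                                                        ∎
    where
    instance
      ep≢0 : NonZero (suc k * p)
      ep≢0 = ℕ.m*n≢0 (suc k) p
    f : Poly
    f = subst (suc k * p) (a (n / (suc k * p)))
    μ[ep]≡0 : μ (suc k * p) ≡ + 0
    μ[ep]≡0 = μ-squareful (ℕ.nonTrivial⇒n>1 p {{prime⇒nonTrivial p-prime}}) (*-monoˡ-∣ p p∣e)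

  paired : ∀ d → .{{_ : NonZero d}} → d ∣ m →
           möbiusTerm a n d +P möbiusTerm a n (d * p) ≈ möbiusTerm (defect a p r) m d
  paired d d∣m = begin
    möbiusTerm a n d +P möbiusTerm a n (d * p)
      ≡⟨ cong₂ _+P_ (möbiusTerm-nonZero a n d) (möbiusTerm-nonZero a n (d * p)) ⟩
    μ d · subst d (a (n / d)) +P μ (d * p) · subst (d * p) (a (n / (d * p)))
      ≡⟨ cong₂ _+P_ (cong (λ x → μ d · subst d (a x)) n/d≡)
                    (cong₂ (λ u x → u · subst (d * p) (a x)) (μ-*-prime p-prime p∤d) n/dp≡) ⟩
    μ d · subst d A +P (- μ d) · subst (d * p) B
      ≈⟨ +-cong (·≈constant* (μ d) _) (≈-trans (·-cong (- μ d) subst-dp) (·≈constant* (- μ d) _)) ⟩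
    constant (μ d) *P subst d A +P negP (constant (μ d)) *P subst d (subst p B)
      ≈⟨ factor (constant (μ d)) (subst d A) (subst d (subst p B)) ⟩
    constant (μ d) *P (subst d A -P subst d (subst p B))
      ≈⟨ *-congˡ (constant (μ d)) (subst-- d A (subst p B)) ⟨
    constant (μ d) *P subst d (defect a p r (m / d))
      ≈⟨ ·≈constant* (μ d) _ ⟨
    μ d · subst d (defect a p r (m / d))
      ≡⟨ möbiusTerm-nonZero (defect a p r) m d ⟨
    möbiusTerm (defect a p r) m d
      ∎
    where
    instance
      dp≢0 : NonZero (d * p)
      dp≢0 = ℕ.m*n≢0 d p
    p∤d : ¬ p ∣ d
    p∤d p∣d = p∤m (∣-trans p∣d d∣m)
    A B : Poly
    A = a (p ^ suc r * (m / d))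
    B = a (p ^ r * (m / d))
    n/d≡ : n / d ≡ p ^ suc r * (m / d)
    n/d≡ = *-/-assoc (p ^ suc r) d∣m
    reorder : ∀ x y z → x * y * z ≡ y * z * x
    reorder = solve-ℕ
    n/dp≡ : n / (d * p) ≡ p ^ r * (m / d)
    n/dp≡ = ≡.trans (cong (_/ (d * p)) (reorder p (p ^ r) m))
                    (≡.trans (m*n/o*n≡m/o (p ^ r * m) p d) (*-/-assoc (p ^ r) d∣m))
    subst-dp : subst (d * p) B ≈ subst d (subst p B)
    subst-dp = ≈-sym (≈-trans (subst-subst d p B) (≈-reflexive (cong (λ x → subst x B) (ℕ.*-comm p d))))
    factor : ∀ k x y → k *P x +P negP k *P y ≈ k *P (x +P negP y)
    factor = solve-∀ ℤ[q]ᵃ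

-- The right-hand side of theorem7 with r shifted by one, written as divisibility.
Congruences : (ℕ → Poly) → Set
Congruences a = ∀ {p} → Prime p → ∀ r m → .{{_ : NonZero m}} → ¬ p ∣ m →
                subst m (qInt (p ^ suc r)) ∣P defect a p r m

-- Strong induction on m: in the Möbius sum of the defect at m, every summand but the first
-- is divisible by the induction hypothesis.
isQGauss⇒congruences : ∀ a → IsQGauss a → Congruences a
isQGauss⇒congruences a gauss {p} p-prime r m = <-rec Holds step m
  where
  instance
    p≢0 : NonZero p
    p≢0 = prime⇒nonZero p-prime
  X : Poly
  X = qInt (p ^ suc r)
  Holds : ℕ → Set
  Holds m = .{{_ : NonZero m}} → ¬ p ∣ m → subst m X ∣P defect a p r m

  step : ∀ m → (∀ {c} → c < m → Holds c) → Holds m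
  step m rec p∤m = ∣P-mobiusSum-head X (defect a p r) m X∣Σ
    λ c c∣m c<m → rec c<m {{∣⇒nonZero c∣m}} λ p∣c → p∤m (∣-trans p∣c c∣m)
    where
    n : ℕ
    n = p ^ suc r * m
    instance
      n≢0 : NonZero n
      n≢0 = ℕ.m*n≢0 (p ^ suc r) m {{ℕ.m^n≢0 p (suc r)}}
    [n]∣Σ : qInt n ∣P mobiusSum a n
    [n]∣Σ = ∣P-respʳ (+-identityʳ _) (modP⇒∣P (mobiusSum a n) [] (gauss n (ℕ.>-nonZero⁻¹ n)))
    X∣Σ : subst m X ∣P mobiusSum (defect a p r) m
    X∣Σ = ∣P-respʳ (mobiusSum-p-part a p-prime r p∤m)
                   (∣P-trans (qInt m , ≈-sym (qInt-*ʳ (p ^ suc r) m)) [n]∣Σ)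

congruences⇒isQGauss : ∀ a → Congruences a → IsQGauss a
congruences⇒isQGauss a congruences n n≥1 =
  ∣P⇒modP (mobiusSum a n) []
    (∣P-respʳ (≈-sym (+-identityʳ _)) (qInt∣-from-cofactors (ℕ.m<n⇒n≢0 n≥1) cofactor))
  where
  cofactor : ∀ p → Prime p → p ∣ n → ∃ λ m → ¬ p ∣ m × qInt n ∣P qInt m *P mobiusSum a n
  cofactor p p-prime p∣n with prime-power-split p-prime {{ℕ.>-nonZero n≥1}} p∣n
  ... | r , m , n≡p^[1+r]m , p∤m =
    m , p∤m , ≡.subst (λ n → qInt n ∣P qInt m *P mobiusSum a n) (≡.sym n≡p^[1+r]m) [n]∣[m]Σ
    where
    instance
      m≢0 : NonZero m
      m≢0 = ℕ.m*n≢0⇒n≢0 (p ^ suc r) {{≡.subst NonZero n≡p^[1+r]m (ℕ.>-nonZero n≥1)}}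
    X : Poly
    X = qInt (p ^ suc r)
    X∣Σ : subst m X ∣P mobiusSum a (p ^ suc r * m)
    X∣Σ = ∣P-respʳ (≈-sym (mobiusSum-p-part a p-prime r p∤m)) (∣P-mobiusSum X (defect a p r) m
            λ c c∣m → congruences p-prime r c {{∣⇒nonZero c∣m}} λ p∣c → p∤m (∣-trans p∣c c∣m))
    [n]∣[m]Σ : qInt (p ^ suc r * m) ∣P qInt m *P mobiusSum a (p ^ suc r * m)
    [n]∣[m]Σ = ∣P-respˡ (≈-sym (qInt-*ʳ (p ^ suc r) m)) (∣P-*-monoˡ (qInt m) X∣Σ)

theorem7 : (a : ℕ → Poly) →
    IsQGauss a ⇔
      (∀ (p m r : ℕ) → Prime p → 1 ≤ m → 1 ≤ r → ¬ (p ∣ m) →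
        a (p ^ r * m) ≡ subst p (a (p ^ (r ∸ 1) * m)) [modP subst m (qInt (p ^ r)) ])
theorem7 a = mk⇔
  (λ gauss → λ
    { p m zero    _       _   ()  _
    ; p m (suc r) p-prime m≥1 _   p∤m →
        ∣P⇒modP (a _) (subst p (a _)) (isQGauss⇒congruences a gauss p-prime r m {{ℕ.>-nonZero m≥1}} p∤m) })
  (λ congruences → congruences⇒isQGauss a λ {p} p-prime r m p∤m →
    modP⇒∣P (a _) (subst p (a _)) (congruences p m (suc r) p-prime (ℕ.>-nonZero⁻¹ m) (s≤s z≤n) p∤m))
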